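{- Let $a,b,c,d\in\mathbb{Z}$ with $abc\neq 0$. If the inequality $\mathcal{L}_3: ax+by+cz+d<0$ has a solution in the positive integers, then $\mathcal{L}_3$ admits an EGZ-generalization, i.e. $R(\mathcal{L}_3,2)=R(\mathcal{L}_3,\mathbb{Z}/3\mathbb{Z})$ (both numbers existing).
   Context: $[1,n]=\{1,\dots,n\}$. For an inequality or equation $\mathcal{L}$ in three variables, given a coloring $\chi:[1,n]\to\{0,\dots,r-1\}$, a solution $(x_1,x_2,x_3)\in[1,n]^3$ is monochromatic if all $\chi(x_i)$ are equal, and zero-sum (for $r=3$) if $\chi(x_1)+\chi(x_2)+\chi(x_3)\equiv0\pmod 3$. $R(\mathcal{L},2)$ is the least $N$ (if it exists) such that for all $n\ge N$ every $2$-coloring of $[1,n]$ has a monochromatic solution of $\mathcal{L}$; $R(\mathcal{L},\mathbb{Z}/3\mathbb{Z})$ is the least $N$ (if it exists) such that for all $n\ge N$ every map $[1,n]\to\{0,1,2\}$ has a zero-sum solution of $\mathcal{L}$. $\mathcal{L}$ admits an EGZ-generalization if $R(\mathcal{L},2)=R(\mathcal{L},\mathbb{Z}/3\mathbb{Z})$. -}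

module Defs where

open import Data.Nat using (ℕ; _≤_; _+_; _%_)
open import Data.Integer using (ℤ; +_; _*_; _<_; 0ℤ)
import Data.Integer as ℤ
open import Data.Fin using (Fin; toℕ)
open import Data.Product using (Σ; _×_; ∃-syntax)
open import Relation.Binary.PropositionalEquality using (_≡_)

Rel3 : Set₁
Rel3 = ℤ → ℤ → ℤ → Set

Ineq : ℤ → ℤ → ℤ → ℤ → Rel3
Ineq a b c d x y z = ((a * x ℤ.+ b * y) ℤ.+ c * z) ℤ.+ d < 0ℤ

InRange : ℕ → ℕ → Set
InRange n x = 1 ≤ x × x ≤ n

SolIn : Rel3 → ℕ → (ℕ → ℕ → ℕ → Set) → Set
SolIn L n Q = ∃[ x ] ∃[ y ] ∃[ z ]
  (InRange n x × InRange n y × InRange n z × L (+ x) (+ y) (+ z) × Q x y z)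

-- Every 2-coloring of [1,n] admits a monochromatic solution of L.
-- (Colorings are given as maps ℕ → Fin 2; only their values on [1,n] matter.)
MonoProp : Rel3 → ℕ → Set
MonoProp L n = (χ : ℕ → Fin 2) →
  SolIn L n (λ x y z → (χ x ≡ χ y) × (χ y ≡ χ z))

ZeroSumProp : Rel3 → ℕ → Set
ZeroSumProp L n = (χ : ℕ → Fin 3) →
  SolIn L n (λ x y z → ((toℕ (χ x) + toℕ (χ y)) + toℕ (χ z)) % 3 ≡ 0)

IsLeastThreshold : (ℕ → Set) → ℕ → Set
IsLeastThreshold P N =
  ((n : ℕ) → N ≤ n → P n) ×
  ((M : ℕ) → ((n : ℕ) → M ≤ n → P n) → N ≤ M)

IsR2 : Rel3 → ℕ → Set
IsR2 L N = IsLeastThreshold (MonoProp L) N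

IsRZ3 : Rel3 → ℕ → Set
IsRZ3 L N = IsLeastThreshold (ZeroSumProp L) N

AdmitsEGZ : Rel3 → Set
AdmitsEGZ L = ∃[ N ] (IsR2 L N × IsRZ3 L N)

-- A 2-colouring is a 3-colouring avoiding one colour, and a zero-sum triple of colours from
-- {0,1} is monochromatic, so the zero-sum property at n implies the monochromatic one.
-- Conversely, a variable whose coefficient is positive (negative) can be moved to 1 (to n)
-- without leaving the solution set, and two of the three variables share such an extreme p;
-- let q be the extreme of the third. Given χ : [1,n] → ℤ/3ℤ, either χ p = χ q and (p,p,q) is
-- monochromatic, or a solution monochromatic for the 2-colouring "χ t = χ p" is monochromatic
-- for χ or avoids χ p, and then moving one or two coordinates to p, q makes it rainbow or
-- monochromatic. So both properties hold for the same n and their least thresholds agree;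
-- the monochromatic property holds from some n on by the pigeonhole principle applied to three
-- points P, M, Q with (P,P,M), (M,M,Q), (P,P,Q) solutions, and the least threshold is then
-- found by a decidable search.

module Submission where

open import Defs
open import Data.Integer using (ℤ; +_; _*_; 0ℤ)
open import Data.Nat using (ℕ; suc)
open import Data.Product using (_×_; ∃-syntax)
open import Relation.Binary.PropositionalEquality using (_≢_)

open import Algebra.Properties.CommutativeSemigroup using (xy∙z≈zx∙y; xy∙z≈xz∙y)
open import Data.Fin using (Fin; zero; suc; toℕ; inject₁; _≟_)
open import Data.Fin.Properties using (all?)
open import Data.Integer using (-[1+_]; -_; ∣_∣; sign)
import Data.Integer as ℤ
import Data.Integer.Properties as ℤ
open import Data.Nat using (zero; _+_; _%_; _≤_; _<_; _⊔_; z≤n; s≤s; s≤s⁻¹; _≤?_)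
import Data.Nat as ℕ
import Data.Nat.Properties as ℕ
open import Data.Nat.Induction using (<-rec)
open import Data.Product using (_,_; proj₂; map₂)
open import Data.Sign using (Sign)
open import Data.Sum using (_⊎_; inj₁; inj₂)
open import Data.Vec using (Vec; []; _∷_)
open import Relation.Nullary using (¬_; Dec; yes; no)
open import Relation.Nullary.Decidable using (map′; from-yes; ¬?; _×-dec_; _→-dec_)
open import Relation.Binary.PropositionalEquality
  using (_≡_; refl; sym; trans; subst; ≢-sym)

twoAlike : ∀ {A : Set} {u v : A} → (∀ w → w ≡ u ⊎ w ≡ v) →
  ∀ p q r → p ≡ q ⊎ q ≡ r ⊎ r ≡ p
twoAlike two p q r with two p | two q | two r
... | inj₁ refl | inj₁ refl | _         = inj₁ refl
... | inj₂ refl | inj₂ refl | _         = inj₁ refl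
... | inj₁ refl | inj₂ refl | inj₁ refl = inj₂ (inj₂ refl)
... | inj₁ refl | inj₂ refl | inj₂ refl = inj₂ (inj₁ refl)
... | inj₂ refl | inj₁ refl | inj₁ refl = inj₂ (inj₁ refl)
... | inj₂ refl | inj₁ refl | inj₂ refl = inj₂ (inj₂ refl)

Fin2-cases : (p : Fin 2) → p ≡ zero ⊎ p ≡ suc zero
Fin2-cases zero       = inj₁ refl
Fin2-cases (suc zero) = inj₂ refl

Sign-cases : (s : Sign) → s ≡ Sign.+ ⊎ s ≡ Sign.-
Sign-cases Sign.+ = inj₁ refl
Sign-cases Sign.- = inj₂ refl

Monochromatic : ∀ {k} → Fin k → Fin k → Fin k → Set
Monochromatic p q r = p ≡ q × q ≡ r

ZeroSum : Fin 3 → Fin 3 → Fin 3 → Set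
ZeroSum p q r = ((toℕ p + toℕ q) + toℕ r) % 3 ≡ 0

monochromatic⇒zeroSum : ∀ {p q r} → Monochromatic p q r → ZeroSum p q r
monochromatic⇒zeroSum {zero}           (refl , refl) = refl
monochromatic⇒zeroSum {suc zero}       (refl , refl) = refl
monochromatic⇒zeroSum {suc (suc zero)} (refl , refl) = refl

zeroSum? : ∀ p q r → Dec (ZeroSum p q r)
zeroSum? p q r = _ ℕ.≟ 0

rainbow⇒zeroSum : ∀ {p q r} → p ≢ q → q ≢ r → r ≢ p → ZeroSum p q r
rainbow⇒zeroSum {p} {q} {r} = from-yes
  (all? λ p → all? λ q → all? λ r →
    ¬? (p ≟ q) →-dec ¬? (q ≟ r) →-dec ¬? (r ≟ p) →-dec zeroSum? p q r) p q r

zeroSum⇒monochromatic : ∀ {p q r : Fin 2} →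
  ZeroSum (inject₁ p) (inject₁ q) (inject₁ r) → Monochromatic p q r
zeroSum⇒monochromatic {p} {q} {r} = from-yes
  (all? λ (p : Fin 2) → all? λ q → all? λ r →
    zeroSum? (inject₁ p) (inject₁ q) (inject₁ r) →-dec ((p ≟ q) ×-dec (q ≟ r))) p q r

indicator : ∀ {A : Set} → Dec A → Fin 2
indicator (yes _) = zero
indicator (no _)  = suc zero

allOrNone : ∀ {A B C : Set} (a? : Dec A) (b? : Dec B) (c? : Dec C) →
  Monochromatic (indicator a?) (indicator b?) (indicator c?) →
  (A × B × C) ⊎ (¬ A × ¬ B × ¬ C)
allOrNone (yes a) (yes b) (yes c) _        = inj₁ (a , b , c)
allOrNone (no ¬a) (no ¬b) (no ¬c) _        = inj₂ (¬a , ¬b , ¬c)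
allOrNone (yes _) (no _)  _       (() , _)
allOrNone (no _)  (yes _) _       (() , _)
allOrNone (yes _) (yes _) (no _)  (_ , ())
allOrNone (no _)  (no _)  (yes _) (_ , ())

SolIn-weaken : ∀ {L Q m n} → m ≤ n → SolIn L m Q → SolIn L n Q
SolIn-weaken m≤n (x , y , z , (1≤x , x≤m) , (1≤y , y≤m) , (1≤z , z≤m) , sol , q) =
  x , y , z , (1≤x , ℕ.≤-trans x≤m m≤n) , (1≤y , ℕ.≤-trans y≤m m≤n) ,
  (1≤z , ℕ.≤-trans z≤m m≤n) , sol , q

SolIn-map : ∀ {L n} {Q Q′ : ℕ → ℕ → ℕ → Set} →
  (∀ {x y z} → InRange n x → InRange n y → InRange n z → Q x y z → Q′ x y z) →
  SolIn L n Q → SolIn L n Q′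
SolIn-map f (x , y , z , x∈ , y∈ , z∈ , sol , q) =
  x , y , z , x∈ , y∈ , z∈ , sol , f x∈ y∈ z∈ q

MonoProp-≤ : ∀ {L m n} → m ≤ n → MonoProp L m → MonoProp L n
MonoProp-≤ {L} m≤n M χ = SolIn-weaken {L} m≤n (M χ)

MonoProp⇒1≤n : ∀ {L n} → MonoProp L n → 1 ≤ n
MonoProp⇒1≤n {L} M with M (λ _ → zero)
... | _ , _ , _ , (1≤x , x≤n) , _ = ℕ.≤-trans 1≤x x≤n

zeroSum⇒mono : ∀ {L n} → ZeroSumProp L n → MonoProp L n
zeroSum⇒mono {L} Z χ =
  SolIn-map {L} (λ _ _ _ → zeroSum⇒monochromatic) (Z (λ x → inject₁ (χ x)))

inRange-any? : ∀ n {P : ℕ → Set} → (∀ x → Dec (P x)) → Dec (∃[ x ] (InRange n x × P x))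
inRange-any? n P? = map′
  (λ (x , x<1+n , 1≤x , Px) → x , (1≤x , s≤s⁻¹ x<1+n) , Px)
  (λ (x , (1≤x , x≤n) , Px) → x , s≤s x≤n , 1≤x , Px)
  (ℕ.anyUpTo? (λ x → 1 ≤? x ×-dec P? x) (suc n))

SolIn? : ∀ {L Q} → (∀ x y z → Dec (L (+ x) (+ y) (+ z))) → (∀ x y z → Dec (Q x y z)) →
  ∀ n → Dec (SolIn L n Q)
SolIn? L? Q? n = map′
  (λ (x , x∈ , y , y∈ , z , z∈ , sol , q) → x , y , z , x∈ , y∈ , z∈ , sol , q)
  (λ (x , y , z , x∈ , y∈ , z∈ , sol , q) → x , x∈ , y , y∈ , z , z∈ , sol , q)
  (inRange-any? n λ x → inRange-any? n λ y → inRange-any? n λ z → L? x y z ×-dec Q? x y z)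

fromVec : ∀ {A : Set} {n} → A → Vec A n → ℕ → A
fromVec d []      _             = d
fromVec d (c ∷ v) zero          = d
fromVec d (c ∷ v) (suc zero)    = c
fromVec d (c ∷ v) (suc (suc x)) = fromVec d v (suc x)

restrict : ∀ {A : Set} → (ℕ → A) → ∀ n → Vec A n
restrict χ zero    = []
restrict χ (suc n) = χ 1 ∷ restrict (λ x → χ (suc x)) n

fromVec-restrict : ∀ {A : Set} (d : A) χ n {x} → InRange n x → fromVec d (restrict χ n) x ≡ χ x
fromVec-restrict d χ zero    {suc x}       (_ , ())
fromVec-restrict d χ (suc n) {suc zero}    _             = refl
fromVec-restrict d χ (suc n) {suc (suc x)} (_ , s≤s x<n) =
  fromVec-restrict d (λ x → χ (suc x)) n (s≤s z≤n , x<n)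

allVec? : ∀ {k} n {P : Vec (Fin k) n → Set} → (∀ v → Dec (P v)) → Dec (∀ v → P v)
allVec? zero    P? = map′ (λ { p [] → p }) (λ ∀P → ∀P []) (P? [])
allVec? (suc n) P? = map′ (λ { ∀P (c ∷ v) → ∀P c v }) (λ ∀P c v → ∀P (c ∷ v))
  (all? λ c → allVec? n λ v → P? (c ∷ v))

MonoProp? : ∀ {L} → (∀ x y z → Dec (L (+ x) (+ y) (+ z))) → ∀ n → Dec (MonoProp L n)
MonoProp? {L} L? n = map′
  (λ ∀v χ → recolour (fromVec-restrict zero χ n) (∀v (restrict χ n)))
  (λ M v → M (fromVec zero v))
  (allVec? n λ v → SolIn? {L} L? (λ x y z → monochromatic? (fromVec zero v) x y z) n)
  where
  monochromatic? : (χ : ℕ → Fin 2) → ∀ x y z → Dec (Monochromatic (χ x) (χ y) (χ z))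
  monochromatic? χ x y z = (χ x ≟ χ y) ×-dec (χ y ≟ χ z)

  recolour : ∀ {χ χ′ : ℕ → Fin 2} → (∀ {x} → InRange n x → χ′ x ≡ χ x) →
    SolIn L n (λ x y z → Monochromatic (χ′ x) (χ′ y) (χ′ z)) →
    SolIn L n (λ x y z → Monochromatic (χ x) (χ y) (χ z))
  recolour χ′≗χ = SolIn-map {L} λ x∈ y∈ z∈ (e₁ , e₂) →
    trans (sym (χ′≗χ x∈)) (trans e₁ (χ′≗χ y∈)) , trans (sym (χ′≗χ y∈)) (trans e₂ (χ′≗χ z∈))

leastWitness : ∀ {P : ℕ → Set} → (∀ n → Dec (P n)) → ∀ {n} → P n →
  ∃[ N ] (P N × (∀ {m} → m < N → ¬ P m))
leastWitness {P} P? {n} = <-rec (λ n → P n → Least) step n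
  where
  Least = ∃[ N ] (P N × (∀ {m} → m < N → ¬ P m))
  step : ∀ n → (∀ {m} → m < n → P m → Least) → P n → Least
  step n below Pn with ℕ.anyUpTo? P? n
  ... | yes (m , m<n , Pm) = below m<n Pm
  ... | no ∄m              = n , Pn , λ m<n Pm → ∄m (_ , m<n , Pm)

leastThreshold : ∀ {P : ℕ → Set} → (∀ n → Dec (P n)) → (∀ {m n} → m ≤ n → P m → P n) →
  ∀ {n} → P n → ∃[ N ] IsLeastThreshold P N
leastThreshold P? P-mono Pn with leastWitness P? Pn
... | N , PN , ¬P<N =
  N , (λ n N≤n → P-mono N≤n PN) , λ M ∀P≥M → ℕ.≮⇒≥ (λ M<N → ¬P<N M<N (∀P≥M M ℕ.≤-refl))

IsLeastThreshold-transfer : ∀ {P Q : ℕ → Set} {N} →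
  (∀ {n} → P n → Q n) → (∀ {n} → Q n → P n) → IsLeastThreshold P N → IsLeastThreshold Q N
IsLeastThreshold-transfer P⇒Q Q⇒P (above , least) =
  (λ n N≤n → P⇒Q (above n N≤n)) , λ M ∀Q≥M → least M (λ n M≤n → Q⇒P (∀Q≥M n M≤n))

-- Relations closed under moving coordinates to extremes

record Extremal (L : Rel3) (n p q : ℕ) : Set where
  field
    p∈ : InRange n p
    q∈ : InRange n q
    moveˣ : ∀ {x y z} → InRange n x → L (+ x) (+ y) (+ z) → L (+ p) (+ y) (+ z)
    moveʸ : ∀ {x y z} → InRange n y → L (+ x) (+ y) (+ z) → L (+ x) (+ p) (+ z)
    moveᶻ : ∀ {x y z} → InRange n z → L (+ x) (+ y) (+ z) → L (+ x) (+ y) (+ q)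

  corner : ∀ {x y z} → InRange n x → InRange n y → InRange n z →
    L (+ x) (+ y) (+ z) → L (+ p) (+ p) (+ q)
  corner x∈ y∈ z∈ sol = moveᶻ z∈ (moveʸ y∈ (moveˣ x∈ sol))

  mono⇒zeroSum : MonoProp L n → ZeroSumProp L n
  mono⇒zeroSum M χ with χ p ≟ χ q | M (λ _ → zero) | M (λ t → indicator (χ t ≟ χ p))
  ... | yes χp≡χq | x , y , z , x∈ , y∈ , z∈ , sol , _ | _ =
    p , p , q , p∈ , p∈ , q∈ , corner x∈ y∈ z∈ sol , monochromatic⇒zeroSum (refl , χp≡χq)
  ... | no χp≢χq | _ | x , y , z , x∈ , y∈ , z∈ , sol , sameSide
    with allOrNone (χ x ≟ χ p) (χ y ≟ χ p) (χ z ≟ χ p) sameSide | χ x ≟ χ q | χ y ≟ χ q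
  ... | inj₁ (χx≡χp , χy≡χp , χz≡χp) | _ | _ =
    x , y , z , x∈ , y∈ , z∈ , sol ,
    monochromatic⇒zeroSum (trans χx≡χp (sym χy≡χp) , trans χy≡χp (sym χz≡χp))
  ... | inj₂ (χx≢χp , _ , _) | no χx≢χq | _ =
    x , p , q , x∈ , p∈ , q∈ , moveᶻ z∈ (moveʸ y∈ sol) ,
    rainbow⇒zeroSum χx≢χp χp≢χq (≢-sym χx≢χq)
  ... | inj₂ (_ , χy≢χp , _) | yes _ | no χy≢χq =
    p , y , q , p∈ , y∈ , q∈ , moveᶻ z∈ (moveˣ x∈ sol) ,
    rainbow⇒zeroSum (≢-sym χy≢χp) χy≢χq (≢-sym χp≢χq)
  ... | inj₂ _ | yes χx≡χq | yes χy≡χq =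
    x , y , q , x∈ , y∈ , q∈ , moveᶻ z∈ sol ,
    monochromatic⇒zeroSum (trans χx≡χq (sym χy≡χq) , χy≡χq)

threePoints⇒MonoProp : ∀ {L n P M Q} → InRange n P → InRange n M → InRange n Q →
  L (+ P) (+ P) (+ M) → L (+ M) (+ M) (+ Q) → L (+ P) (+ P) (+ Q) → MonoProp L n
threePoints⇒MonoProp {P = P} {M} {Q} P∈ M∈ Q∈ PPM MMQ PPQ χ
  with twoAlike Fin2-cases (χ P) (χ M) (χ Q)
... | inj₁ χP≡χM        = P , P , M , P∈ , P∈ , M∈ , PPM , refl , χP≡χM
... | inj₂ (inj₁ χM≡χQ) = M , M , Q , M∈ , M∈ , Q∈ , MMQ , refl , χM≡χQ
... | inj₂ (inj₂ χQ≡χP) = P , P , Q , P∈ , P∈ , Q∈ , PPQ , refl , sym χQ≡χP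

Ineq? : ∀ a b c d x y z → Dec (Ineq a b c d (+ x) (+ y) (+ z))
Ineq? a b c d x y z = _ ℤ.<? _

Ineq-push : ∀ {a b c d x y z x′ y′ z′} →
  a * x′ ℤ.≤ a * x → b * y′ ℤ.≤ b * y → c * z′ ℤ.≤ c * z →
  Ineq a b c d x y z → Ineq a b c d x′ y′ z′
Ineq-push {d = d} ax′≤ax by′≤by cz′≤cz =
  ℤ.≤-<-trans (ℤ.+-monoˡ-≤ d (ℤ.+-mono-≤ (ℤ.+-mono-≤ ax′≤ax by′≤by) cz′≤cz))

Ineq-rotate : ∀ a b c d {x y z} → Ineq a b c d x y z → Ineq c a b d z x y
Ineq-rotate a b c d {x} {y} {z} = subst (λ t → t ℤ.+ d ℤ.< 0ℤ)
  (xy∙z≈zx∙y ℤ.+-commutativeSemigroup (a * x) (b * y) (c * z))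

SolIn-rotate : ∀ a b c d {n} {Q : ℕ → ℕ → ℕ → Set} → (∀ {x y z} → Q x y z → Q z x y) →
  SolIn (Ineq a b c d) n Q → SolIn (Ineq c a b d) n Q
SolIn-rotate a b c d rotQ (x , y , z , x∈ , y∈ , z∈ , sol , q) =
  z , x , y , z∈ , x∈ , y∈ , Ineq-rotate a b c d sol , rotQ q

MonoProp-rotate : ∀ a b c d {n} → MonoProp (Ineq a b c d) n → MonoProp (Ineq c a b d) n
MonoProp-rotate a b c d M χ = SolIn-rotate a b c d (λ (e₁ , e₂) → sym (trans e₁ e₂) , e₁) (M χ)

ZeroSumProp-rotate : ∀ a b c d {n} → ZeroSumProp (Ineq a b c d) n → ZeroSumProp (Ineq c a b d) n
ZeroSumProp-rotate a b c d Z χ = SolIn-rotate a b c d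
  (λ {x} {y} {z} → subst (λ t → t % 3 ≡ 0)
    (xy∙z≈zx∙y ℕ.+-commutativeSemigroup (toℕ (χ x)) (toℕ (χ y)) (toℕ (χ z)))) (Z χ)

-- Moving a variable towards this end of [1,n] cannot increase its term in ax + by + cz.
extreme : Sign → ℕ → ℕ
extreme Sign.+ _ = 1
extreme Sign.- n = n

extreme-inRange : ∀ s {n} → 1 ≤ n → InRange n (extreme s n)
extreme-inRange Sign.+ 1≤n = ℕ.≤-refl , 1≤n
extreme-inRange Sign.- 1≤n = 1≤n , ℕ.≤-refl

*-extreme-≤ : ∀ k {n x} → InRange n x → k * + extreme (sign k) n ℤ.≤ k * + x
*-extreme-≤ (+ m)     (1≤x , _)  = ℤ.*-monoˡ-≤-nonNeg (+ m) (ℤ.+≤+ 1≤x)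
*-extreme-≤ -[1+ m ] (_ , x≤n) = ℤ.*-monoˡ-≤-nonPos -[1+ m ] (ℤ.+≤+ x≤n)

Ineq-extremal : ∀ {a b c d n} → sign a ≡ sign b → 1 ≤ n →
  Extremal (Ineq a b c d) n (extreme (sign a) n) (extreme (sign c) n)
Ineq-extremal {a} {b} {c} {d} {n} sa≡sb 1≤n = record
  { p∈    = extreme-inRange (sign a) 1≤n
  ; q∈    = extreme-inRange (sign c) 1≤n
  ; moveˣ = λ x∈ → Ineq-push {a} {b} {c} {d} (*-extreme-≤ a x∈) ℤ.≤-refl ℤ.≤-refl
  ; moveʸ = λ {_} {y} y∈ → Ineq-push {a} {b} {c} {d} ℤ.≤-refl
      (subst (λ s → b * + extreme s n ℤ.≤ b * + y) (sym sa≡sb) (*-extreme-≤ b y∈)) ℤ.≤-refl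
  ; moveᶻ = λ z∈ → Ineq-push {a} {b} {c} {d} ℤ.≤-refl ℤ.≤-refl (*-extreme-≤ c z∈)
  }

Ineq-mono⇒zeroSum-≡sign : ∀ a b c d {n} → sign a ≡ sign b →
  MonoProp (Ineq a b c d) n → ZeroSumProp (Ineq a b c d) n
Ineq-mono⇒zeroSum-≡sign a b c d sa≡sb M =
  Extremal.mono⇒zeroSum (Ineq-extremal {a} {b} {c} {d} sa≡sb (MonoProp⇒1≤n {Ineq a b c d} M)) M

Ineq-mono⇒zeroSum : ∀ a b c d {n} → MonoProp (Ineq a b c d) n → ZeroSumProp (Ineq a b c d) n
Ineq-mono⇒zeroSum a b c d M with twoAlike Sign-cases (sign a) (sign b) (sign c)
... | inj₁ sa≡sb        = Ineq-mono⇒zeroSum-≡sign a b c d sa≡sb M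
... | inj₂ (inj₁ sb≡sc) = ZeroSumProp-rotate b c a d
  (Ineq-mono⇒zeroSum-≡sign b c a d sb≡sc (MonoProp-rotate c a b d (MonoProp-rotate a b c d M)))
... | inj₂ (inj₂ sc≡sa) = ZeroSumProp-rotate b c a d (ZeroSumProp-rotate c a b d
  (Ineq-mono⇒zeroSum-≡sign c a b d sc≡sa (MonoProp-rotate a b c d M)))

-[1+m]*n≤-n : ∀ m n → -[1+ m ] * + n ℤ.≤ - + n
-[1+m]*n≤-n m n = begin
  -[1+ m ] * + n ≤⟨ ℤ.*-monoʳ-≤-nonNeg (+ n) (ℤ.-≤- {m} {0} z≤n) ⟩
  -[1+ 0 ] * + n ≡⟨ ℤ.-1*i≡-i (+ n) ⟩
  - + n          ∎
  where open ℤ.≤-Reasoning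

i<1+∣i∣+m : ∀ i m → i ℤ.< + suc (∣ i ∣ + m)
i<1+∣i∣+m (+ k)     m = ℤ.+<+ (s≤s (ℕ.m≤m+n k m))
i<1+∣i∣+m -[1+ k ] m = ℤ.-<+

u+v+d<0 : ∀ u v d {n} → u ℤ.+ d ℤ.< + n → v ℤ.≤ - + n → (u ℤ.+ v) ℤ.+ d ℤ.< 0ℤ
u+v+d<0 u v d {n} u+d<n v≤-n = begin-strict
  (u ℤ.+ v) ℤ.+ d ≡⟨ xy∙z≈xz∙y ℤ.+-commutativeSemigroup u v d ⟩
  (u ℤ.+ d) ℤ.+ v <⟨ ℤ.+-mono-<-≤ u+d<n v≤-n ⟩
  + n ℤ.+ - + n   ≡⟨ ℤ.+-inverseʳ (+ n) ⟩
  0ℤ              ∎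
  where open ℤ.≤-Reasoning

Ineq-corner : ∀ a b c d {x y z n} → sign a ≡ sign b →
  Ineq a b c d (+ suc x) (+ suc y) (+ suc z) → suc x ⊔ suc y ⊔ suc z ≤ n →
  Ineq a b c d (+ extreme (sign a) n) (+ extreme (sign a) n) (+ extreme (sign c) n)
Ineq-corner a b c d {x} {y} {z} sa≡sb sol m≤n =
  Extremal.corner (Ineq-extremal {a} {b} {c} {d} sa≡sb (ℕ.≤-trans (s≤s z≤n) sz≤n))
    (s≤s z≤n , sx≤n) (s≤s z≤n , sy≤n) (s≤s z≤n , sz≤n) sol
  where
  sx≤n : suc x ≤ _
  sx≤n = ℕ.≤-trans (ℕ.≤-trans (ℕ.m≤m⊔n (suc x) (suc y)) (ℕ.m≤m⊔n _ (suc z))) m≤n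
  sy≤n : suc y ≤ _
  sy≤n = ℕ.≤-trans (ℕ.≤-trans (ℕ.m≤n⊔m (suc x) (suc y)) (ℕ.m≤m⊔n _ (suc z))) m≤n
  sz≤n : suc z ≤ _
  sz≤n = ℕ.≤-trans (ℕ.m≤n⊔m (suc x ⊔ suc y) (suc z)) m≤n

-- With m = max(x,y,z), the three points are the ends of [1,N] and m: two of the triples
-- are corners, for the ranges [1,m] and [1,N], and N is taken so large that in the third
-- the terms at N, whose coefficients are negative, outweigh the rest.
1≤suc⊔ : ∀ x y z → 1 ≤ suc x ⊔ suc y ⊔ suc z
1≤suc⊔ x y z = ℕ.≤-trans (s≤s z≤n) (ℕ.m≤n⊔m (suc x ⊔ suc y) (suc z))

Ineq-monoThreshold-≡sign : ∀ a b c d {x y z} → sign a ≡ sign b →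
  Ineq a b c d (+ suc x) (+ suc y) (+ suc z) → ∃[ n ] MonoProp (Ineq a b c d) n
Ineq-monoThreshold-≡sign (+ i) (+ j) (+ k) d {x} {y} {z} refl sol =
  m , threePoints⇒MonoProp {Ineq (+ i) (+ j) (+ k) d} 1∈ 1∈ 1∈ corner corner corner
  where
  m = suc x ⊔ suc y ⊔ suc z
  1∈ : InRange m 1
  1∈ = ℕ.≤-refl , 1≤suc⊔ x y z
  corner = Ineq-corner (+ i) (+ j) (+ k) d {x} {y} {z} refl sol ℕ.≤-refl
Ineq-monoThreshold-≡sign -[1+ i ] -[1+ j ] -[1+ k ] d {x} {y} {z} refl sol =
  m , threePoints⇒MonoProp {Ineq -[1+ i ] -[1+ j ] -[1+ k ] d} m∈ m∈ m∈ corner corner corner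
  where
  m = suc x ⊔ suc y ⊔ suc z
  m∈ : InRange m m
  m∈ = 1≤suc⊔ x y z , ℕ.≤-refl
  corner = Ineq-corner -[1+ i ] -[1+ j ] -[1+ k ] d {x} {y} {z} refl sol ℕ.≤-refl
Ineq-monoThreshold-≡sign (+ i) (+ j) -[1+ k ] d {x} {y} {z} refl sol =
  N , threePoints⇒MonoProp {Ineq (+ i) (+ j) -[1+ k ] d}
        (ℕ.≤-refl , s≤s z≤n) (1≤suc⊔ x y z , m≤N) (s≤s z≤n , ℕ.≤-refl)
        (corner ℕ.≤-refl) mmN (corner m≤N)
  where
  m = suc x ⊔ suc y ⊔ suc z
  N = suc (∣ (+ i * + m ℤ.+ + j * + m) ℤ.+ d ∣ + m)
  m≤N : m ≤ N
  m≤N = ℕ.m≤n⇒m≤1+n (ℕ.m≤n+m m _)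
  corner : ∀ {n} → m ≤ n → Ineq (+ i) (+ j) -[1+ k ] d (+ 1) (+ 1) (+ n)
  corner = Ineq-corner (+ i) (+ j) -[1+ k ] d {x} {y} {z} refl sol
  mmN : Ineq (+ i) (+ j) -[1+ k ] d (+ m) (+ m) (+ N)
  mmN = u+v+d<0 (+ i * + m ℤ.+ + j * + m) (-[1+ k ] * + N) d (i<1+∣i∣+m _ m) (-[1+m]*n≤-n k N)
Ineq-monoThreshold-≡sign -[1+ i ] -[1+ j ] (+ k) d {x} {y} {z} refl sol =
  N , threePoints⇒MonoProp {Ineq -[1+ i ] -[1+ j ] (+ k) d}
        (s≤s z≤n , ℕ.≤-refl) (1≤suc⊔ x y z , m≤N) (ℕ.≤-refl , s≤s z≤n)
        NNm (corner ℕ.≤-refl) (corner m≤N)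
  where
  m = suc x ⊔ suc y ⊔ suc z
  N = suc (∣ + k * + m ℤ.+ d ∣ + m)
  m≤N : m ≤ N
  m≤N = ℕ.m≤n⇒m≤1+n (ℕ.m≤n+m m _)
  corner : ∀ {n} → m ≤ n → Ineq -[1+ i ] -[1+ j ] (+ k) d (+ n) (+ n) (+ 1)
  corner = Ineq-corner -[1+ i ] -[1+ j ] (+ k) d {x} {y} {z} refl sol
  aN+bN≤-N : -[1+ i ] * + N ℤ.+ -[1+ j ] * + N ℤ.≤ - + N
  aN+bN≤-N = begin
    -[1+ i ] * + N ℤ.+ -[1+ j ] * + N
      ≤⟨ ℤ.+-mono-≤ (-[1+m]*n≤-n i N) (ℤ.≤-trans (-[1+m]*n≤-n j N) (ℤ.neg-≤-pos {N} {0})) ⟩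
    - + N ℤ.+ 0ℤ
      ≡⟨ ℤ.+-identityʳ (- + N) ⟩
    - + N ∎
    where open ℤ.≤-Reasoning
  NNm : Ineq -[1+ i ] -[1+ j ] (+ k) d (+ N) (+ N) (+ m)
  NNm = subst (λ t → t ℤ.+ d ℤ.< 0ℤ) (ℤ.+-comm (+ k * + m) _)
    (u+v+d<0 (+ k * + m) (-[1+ i ] * + N ℤ.+ -[1+ j ] * + N) d (i<1+∣i∣+m _ m) aN+bN≤-N)
Ineq-monoThreshold-≡sign (+ _) -[1+ _ ] _ _ () _
Ineq-monoThreshold-≡sign -[1+ _ ] (+ _) _ _ () _

Ineq-monoThreshold : ∀ a b c d {x y z} →
  Ineq a b c d (+ suc x) (+ suc y) (+ suc z) → ∃[ n ] MonoProp (Ineq a b c d) n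
Ineq-monoThreshold a b c d sol with twoAlike Sign-cases (sign a) (sign b) (sign c)
... | inj₁ sa≡sb        = Ineq-monoThreshold-≡sign a b c d sa≡sb sol
... | inj₂ (inj₁ sb≡sc) = map₂ (MonoProp-rotate b c a d)
  (Ineq-monoThreshold-≡sign b c a d sb≡sc (Ineq-rotate c a b d (Ineq-rotate a b c d sol)))
... | inj₂ (inj₂ sc≡sa) = map₂ (λ M → MonoProp-rotate b c a d (MonoProp-rotate c a b d M))
  (Ineq-monoThreshold-≡sign c a b d sc≡sa (Ineq-rotate a b c d sol))

corollary1 : (a b c d : ℤ) → a * b * c ≢ 0ℤ →
    (∃[ x ] ∃[ y ] ∃[ z ] (Ineq a b c d (+ suc x) (+ suc y) (+ suc z))) →
    AdmitsEGZ (Ineq a b c d)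
-- The hypothesis abc ≠ 0 is not needed: a zero coefficient behaves like a positive one.
corollary1 a b c d _ (_ , _ , _ , sol)
  with leastThreshold (MonoProp? {Ineq a b c d} (Ineq? a b c d))
         (MonoProp-≤ {Ineq a b c d})
         (proj₂ (Ineq-monoThreshold a b c d sol))
... | N , isR₂ = N , isR₂ ,
  IsLeastThreshold-transfer (Ineq-mono⇒zeroSum a b c d) (zeroSum⇒mono {Ineq a b c d}) isR₂
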